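{- Let $\mathcal{C}\subseteq\operatorname{Av}(321)$ be a permutation class such that $\mathcal{C}\cap U$ is finite. Then there is a number $\ell$ such that for every $\pi\in\mathcal{C}$ whose inversion graph $G_\pi$ is connected, the distance in $G_\pi$ between any two vertices of degree at least three is at most $\ell$.
   Context: For a permutation $\pi$, the inversion graph $G_\pi$ has vertex set $\{(i,\pi(i))\}$, with $(i,\pi(i))$ and $(j,\pi(j))$ adjacent if $i<j$ and $\pi(i)>\pi(j)$. A double-ended fork is the graph formed from a path by adding four new vertices of degree one, two adjacent to one end of the path and two adjacent to the other end. $U$ is the set of all permutations $\pi$ whose inversion graph $G_\pi$ is isomorphic to a double-ended fork. $\operatorname{Av}(321)$ is the class of permutations with no decreasing subsequence of length $3$. -}

module Defs where

open import Data.Nat using (ℕ; zero; suc; _≤_; _<_; _<ᵇ_)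
open import Data.Bool using (Bool; true; false; _∧_; _∨_; T)
open import Data.Fin using (Fin; toℕ; cast) renaming (zero to fz; suc to fs)
open import Data.List using (List; length; filter; allFin)
open import Data.List.Relation.Unary.Any using (Any)
open import Data.Product using (Σ; _×_; _,_; ∃-syntax)
open import Data.Sum using (_⊎_; inj₁; inj₂)
open import Data.Empty using (⊥)
open import Relation.Nullary using (¬_)
open import Relation.Binary.PropositionalEquality using (_≡_; refl)
open import Function.Bundles using (_↔_; Inverse)
open import Function.Definitions using (Injective)

-- Permutations of [n] = Fin n, as injective maps Fin n → Fin n
-- (injective endomaps of a finite set are bijections).

record Perm : Set where
  constructor perm
  field
    len : ℕ
    fun : Fin len → Fin len
    inj : Injective _≡_ _≡_ fun
open Perm public

_<F_ : {n : ℕ} → Fin n → Fin n → Set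
i <F j = toℕ i < toℕ j

_≼_ : Perm → Perm → Set
σ ≼ π = Σ (Fin (len σ) → Fin (len π)) λ f →
          (∀ i j → i <F j → f i <F f j) ×
          (∀ i j → (fun σ i <F fun σ j → fun π (f i) <F fun π (f j))
                 × (fun π (f i) <F fun π (f j) → fun σ i <F fun σ j))

IsPermClass : (Perm → Set) → Set
IsPermClass C = ∀ σ π → C π → σ ≼ π → C σ

f321 : Fin 3 → Fin 3
f321 fz = fs (fs fz)
f321 (fs fz) = fs fz
f321 (fs (fs fz)) = fz

f321-inj : Injective _≡_ _≡_ f321
f321-inj {fz} {fz} _ = refl
f321-inj {fz} {fs fz} ()
f321-inj {fz} {fs (fs fz)} ()
f321-inj {fs fz} {fz} ()
f321-inj {fs fz} {fs fz} _ = refl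
f321-inj {fs fz} {fs (fs fz)} ()
f321-inj {fs (fs fz)} {fz} ()
f321-inj {fs (fs fz)} {fs fz} ()
f321-inj {fs (fs fz)} {fs (fs fz)} _ = refl

p321 : Perm
p321 = perm 3 f321 f321-inj

Av321 : Perm → Set
Av321 π = ¬ (p321 ≼ π)

-- Inversion graph G_π on vertex set Fin (len π)  (vertex i ↔ (i, π(i)))

invAdjᵇ : (π : Perm) → Fin (len π) → Fin (len π) → Bool
invAdjᵇ π i j = ((toℕ i <ᵇ toℕ j) ∧ (toℕ (fun π j) <ᵇ toℕ (fun π i)))
              ∨ ((toℕ j <ᵇ toℕ i) ∧ (toℕ (fun π i) <ᵇ toℕ (fun π j)))

InvAdj : (π : Perm) → Fin (len π) → Fin (len π) → Set
InvAdj π i j = T (invAdjᵇ π i j)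

degree : (π : Perm) → Fin (len π) → ℕ
degree π i = length (filter (λ j → T? (invAdjᵇ π i j)) (allFin (len π)))
  where
  open import Relation.Nullary.Decidable using (Dec)
  open import Data.Bool.Properties using (T?)

data Walk (π : Perm) : Fin (len π) → Fin (len π) → ℕ → Set where
  here : ∀ {u} → Walk π u u 0
  step : ∀ {u v w k} → InvAdj π u v → Walk π v w k → Walk π u w (suc k)

Connected : Perm → Set
Connected π = ∀ u v → ∃[ k ] Walk π u v k

DistAtMost : (π : Perm) → Fin (len π) → Fin (len π) → ℕ → Set
DistAtMost π u v ℓ = ∃[ k ] (k ≤ ℓ × Walk π u v k)

-- Double-ended fork: path on (suc m) vertices p_0..p_m (inj₁), plus four
-- leaves (inj₂): leaves 0,1 adjacent to p_0, leaves 2,3 adjacent to p_m.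

ForkV : ℕ → Set
ForkV m = Fin (suc m) ⊎ Fin 4

PathLeafAdj : (m : ℕ) → Fin (suc m) → Fin 4 → Set
PathLeafAdj m i l = (toℕ i ≡ 0 × toℕ l < 2) ⊎ (toℕ i ≡ m × 2 ≤ toℕ l)

ForkAdj : (m : ℕ) → ForkV m → ForkV m → Set
ForkAdj m (inj₁ i) (inj₁ j) = (toℕ j ≡ suc (toℕ i)) ⊎ (toℕ i ≡ suc (toℕ j))
ForkAdj m (inj₁ i) (inj₂ l) = PathLeafAdj m i l
ForkAdj m (inj₂ l) (inj₁ i) = PathLeafAdj m i l
ForkAdj m (inj₂ _) (inj₂ _) = ⊥

InvGraphIsoFork : Perm → ℕ → Set
InvGraphIsoFork π m = Σ (Fin (len π) ↔ ForkV m) λ φ →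
  ∀ i j → (InvAdj π i j → ForkAdj m (Inverse.to φ i) (Inverse.to φ j))
        × (ForkAdj m (Inverse.to φ i) (Inverse.to φ j) → InvAdj π i j)

InU : Perm → Set
InU π = ∃[ m ] InvGraphIsoFork π m

-- Finiteness of a set of permutations: all members occur in a finite list
-- (permutations compared by length and values).

SamePerm : Perm → Perm → Set
SamePerm π σ = Σ (len π ≡ len σ) λ e → ∀ i → toℕ (fun π i) ≡ toℕ (fun σ (cast e i))

FinitePerms : (Perm → Set) → Set
FinitePerms S = ∃[ L ] (∀ π → S π → Any (SamePerm π) L)

module Submission where

-- Let u, v have degree ≥ 3 and join them by a geodesic p₀ … p_d.
-- Since π avoids 321, G_π is triangle-free.  At each end of the geodesic two
-- extra neighbours of p₀ (resp. p_d) give two pendant leaves attached either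
-- at p₀ or at p₂ (resp. p_d or p_{d-2}); the geodesic property guarantees
-- that these leaves meet the path only at their attachment vertex, and when
-- d ≥ 4 the four leaves are pairwise distinct and non-adjacent.  Hence G_π
-- contains an induced double-ended fork with at least d - 3 path vertices.
-- An induced subgraph of G_π on a vertex set is the inversion graph of the
-- pattern of π on that set, so this pattern lies in C ∩ U, and its length is
-- at least d.  Finiteness of C ∩ U bounds these lengths, hence bounds d.

open import Defs
open import Data.Nat using (ℕ; zero; suc; _≤_; _<_; _<ᵇ_; z≤n; s≤s; _+_; _∸_; _⊔_)
open import Data.Nat.Properties
open import Data.Bool using (Bool; true; false; T; if_then_else_)
open import Data.Bool.Properties using (T?; T-∧; T-∨)
open import Data.Unit using (tt)
open import Data.Fin using (Fin; toℕ; fromℕ<; punchOut; splitAt)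
  renaming (zero to fz; suc to fs)
open import Data.Fin.Properties
  using (toℕ-injective; toℕ-fromℕ<; punchOut-injective; injective⇒≤; any?; toℕ≤pred[n]; +↔⊎)
  renaming (_≟_ to _≟F_)
open import Data.List using (List; []; _∷_; length; filter; allFin)
open import Data.List.Membership.Propositional using (_∈_)
open import Data.List.Membership.Propositional.Properties using (∈-filter⁻)
open import Data.List.Relation.Unary.Any using (Any; here; there)
open import Data.List.Relation.Unary.All using (_∷_)
open import Data.List.Relation.Unary.AllPairs using (_∷_)
open import Data.List.Relation.Unary.Unique.Propositional using (Unique)
open import Data.List.Relation.Unary.Unique.Propositional.Properties using (allFin⁺; filter⁺)
open import Data.Product using (Σ; _×_; _,_; proj₁; proj₂; ∃-syntax)
open import Data.Sum using (_⊎_; inj₁; inj₂; [_,_]′) renaming (map to map⊎)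
open import Data.Empty using (⊥; ⊥-elim)
open import Function using (_∘_)
open import Function.Bundles using (Equivalence; Injection; Inverse; _↔_; mk↔ₛ′)
open import Function.Definitions using (Injective)
open import Function.Properties.Inverse using (↔-trans; ↔⇒↣)
open import Relation.Nullary using (¬_; yes; no; Dec)
open import Relation.Binary.PropositionalEquality
  using (_≡_; _≢_; refl; sym; trans; cong; subst; subst₂; module ≡-Reasoning)
open import Relation.Binary.Definitions using (tri<; tri≈; tri>)

count : ∀ {k} → (Fin k → Bool) → ℕ
count {zero} P = 0
count {suc k} P = (if P fz then 1 else 0) + count (P ∘ fs)

count-mono : ∀ {k} (P Q : Fin k → Bool) → (∀ i → T (P i) → T (Q i)) → count P ≤ count Q
count-mono {zero} P Q P⇒Q = z≤n
count-mono {suc k} P Q P⇒Q with P fz | Q fz | P⇒Q fz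
... | true  | true  | _ = s≤s (count-mono _ _ (P⇒Q ∘ fs))
... | true  | false | h = ⊥-elim (h tt)
... | false | true  | _ = m≤n⇒m≤1+n (count-mono _ _ (P⇒Q ∘ fs))
... | false | false | _ = count-mono _ _ (P⇒Q ∘ fs)

count-strict : ∀ {k} (P Q : Fin k → Bool) → (∀ i → T (P i) → T (Q i)) →
  (j : Fin k) → T (Q j) → ¬ T (P j) → count P < count Q
count-strict {suc k} P Q P⇒Q fz Qj ¬Pj with P fz | Q fz | P⇒Q fz
... | true  | _     | _ = ⊥-elim (¬Pj tt)
... | false | true  | _ = s≤s (count-mono _ _ (P⇒Q ∘ fs))
... | false | false | _ = ⊥-elim Qj
count-strict {suc k} P Q P⇒Q (fs j) Qj ¬Pj with P fz | Q fz | P⇒Q fz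
... | true  | true  | _ = s≤s (count-strict _ _ (P⇒Q ∘ fs) j Qj ¬Pj)
... | true  | false | h = ⊥-elim (h tt)
... | false | true  | _ = m≤n⇒m≤1+n (count-strict _ _ (P⇒Q ∘ fs) j Qj ¬Pj)
... | false | false | _ = count-strict _ _ (P⇒Q ∘ fs) j Qj ¬Pj

count-all : ∀ k → count {k} (λ _ → true) ≡ k
count-all zero = refl
count-all (suc k) = cong suc (count-all k)

-- No value lies strictly below itself, so a is not counted in its own rank.
<ᵇ-irrefl : ∀ n → ¬ T (n <ᵇ n)
<ᵇ-irrefl n t = <-irrefl refl (<ᵇ⇒< n n t)

module Rank {K : ℕ} (g : Fin K → ℕ) (g-inj : Injective _≡_ _≡_ g) where
  rank : Fin K → ℕ
  rank a = count (λ b → g b <ᵇ g a)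

  rank-bounded : ∀ a → rank a < K
  rank-bounded a = subst (rank a <_) (count-all K)
    (count-strict _ (λ _ → true) (λ _ _ → tt) a tt (<ᵇ-irrefl (g a)))

  rank-mono : ∀ a b → g a < g b → rank a < rank b
  rank-mono a b ga<gb = count-strict _ _
    (λ i t → <⇒<ᵇ (<-trans (<ᵇ⇒< _ _ t) ga<gb)) a (<⇒<ᵇ ga<gb) (<ᵇ-irrefl (g a))

  rank-reflects : ∀ a b → rank a < rank b → g a < g b
  rank-reflects a b r< with <-cmp (g a) (g b)
  ... | tri< ga<gb _ _ = ga<gb
  ... | tri≈ _ ga≡gb _ = ⊥-elim (<-irrefl (cong rank (g-inj ga≡gb)) r<)
  ... | tri> _ _ gb<ga = ⊥-elim (<-asym r< (rank-mono b a gb<ga))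

  rank-injective : ∀ a b → rank a ≡ rank b → a ≡ b
  rank-injective a b r≡ with <-cmp (g a) (g b)
  ... | tri< ga<gb _ _ = ⊥-elim (<-irrefl r≡ (rank-mono a b ga<gb))
  ... | tri≈ _ ga≡gb _ = g-inj ga≡gb
  ... | tri> _ _ gb<ga = ⊥-elim (<-irrefl (sym r≡) (rank-mono b a gb<ga))

  rk : Fin K → Fin K
  rk a = fromℕ< (rank-bounded a)

  rk-toℕ : ∀ a → toℕ (rk a) ≡ rank a
  rk-toℕ a = toℕ-fromℕ< (rank-bounded a)

  rk-injective : Injective _≡_ _≡_ rk
  rk-injective {a} {b} e =
    rank-injective a b (trans (sym (rk-toℕ a)) (trans (cong toℕ e) (rk-toℕ b)))

injective⇒surjective : ∀ {K} {f : Fin K → Fin K} → Injective _≡_ _≡_ f →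
  ∀ i → Σ (Fin K) λ a → f a ≡ i
injective⇒surjective {suc K} {f} f-inj i with any? (λ a → f a ≟F i)
... | yes hit = hit
... | no miss = ⊥-elim (<-irrefl refl (injective⇒≤ squeezed-inj))
  where
  avoids : ∀ a → i ≢ f a
  avoids a e = miss (a , sym e)
  squeezed : Fin (suc K) → Fin K
  squeezed a = punchOut (avoids a)
  squeezed-inj : Injective _≡_ _≡_ squeezed
  squeezed-inj e = f-inj (punchOut-injective (avoids _) (avoids _) e)

Inversion : (π : Perm) → Fin (len π) → Fin (len π) → Set
Inversion π i j = (i <F j × fun π j <F fun π i) ⊎ (j <F i × fun π i <F fun π j)

adj⇒inversion : ∀ π i j → InvAdj π i j → Inversion π i j
adj⇒inversion π i j t with Equivalence.to T-∨ t
... | inj₁ a = let (x , y) = Equivalence.to T-∧ a in inj₁ (<ᵇ⇒< _ _ x , <ᵇ⇒< _ _ y)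
... | inj₂ a = let (x , y) = Equivalence.to T-∧ a in inj₂ (<ᵇ⇒< _ _ x , <ᵇ⇒< _ _ y)

inversion⇒adj : ∀ π i j → Inversion π i j → InvAdj π i j
inversion⇒adj π i j (inj₁ (x , y)) = Equivalence.from T-∨ (inj₁ (Equivalence.from T-∧ (<⇒<ᵇ x , <⇒<ᵇ y)))
inversion⇒adj π i j (inj₂ (x , y)) = Equivalence.from T-∨ (inj₂ (Equivalence.from T-∧ (<⇒<ᵇ x , <⇒<ᵇ y)))

adj-sym : ∀ π i j → InvAdj π i j → InvAdj π j i
adj-sym π i j a with adj⇒inversion π i j a
... | inj₁ inv = inversion⇒adj π j i (inj₂ inv)
... | inj₂ inv = inversion⇒adj π j i (inj₁ inv)

adj-irrefl : ∀ π i → ¬ InvAdj π i i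
adj-irrefl π i a with adj⇒inversion π i i a
... | inj₁ (i<i , _) = <-irrefl refl i<i
... | inj₂ (i<i , _) = <-irrefl refl i<i

contains321 : ∀ π (i j k : Fin (len π)) → i <F j → j <F k →
  fun π k <F fun π j → fun π j <F fun π i → p321 ≼ π
contains321 π i j k i<j j<k πk<πj πj<πi = occ , increasing , λ a b → to a b , from a b
  where
  occ : Fin 3 → Fin (len π)
  occ fz = i
  occ (fs fz) = j
  occ (fs (fs fz)) = k
  increasing : ∀ a b → a <F b → occ a <F occ b
  increasing fz (fs fz) _ = i<j
  increasing fz (fs (fs fz)) _ = <-trans i<j j<k
  increasing (fs fz) (fs (fs fz)) _ = j<k
  increasing fz fz ()
  increasing (fs fz) fz ()
  increasing (fs fz) (fs fz) (s≤s ())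
  increasing (fs (fs fz)) fz ()
  increasing (fs (fs fz)) (fs fz) (s≤s ())
  increasing (fs (fs fz)) (fs (fs fz)) (s≤s (s≤s ()))
  to : ∀ a b → fun p321 a <F fun p321 b → fun π (occ a) <F fun π (occ b)
  to fz fz (s≤s (s≤s ()))
  to fz (fs fz) (s≤s ())
  to fz (fs (fs fz)) ()
  to (fs fz) fz _ = πj<πi
  to (fs fz) (fs fz) (s≤s ())
  to (fs fz) (fs (fs fz)) ()
  to (fs (fs fz)) fz _ = <-trans πk<πj πj<πi
  to (fs (fs fz)) (fs fz) _ = πk<πj
  to (fs (fs fz)) (fs (fs fz)) ()
  from : ∀ a b → fun π (occ a) <F fun π (occ b) → fun p321 a <F fun p321 b
  from fz fz x = ⊥-elim (<-irrefl refl x)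
  from fz (fs fz) x = ⊥-elim (<-asym x πj<πi)
  from fz (fs (fs fz)) x = ⊥-elim (<-asym x (<-trans πk<πj πj<πi))
  from (fs fz) fz x = s≤s (s≤s z≤n)
  from (fs fz) (fs fz) x = ⊥-elim (<-irrefl refl x)
  from (fs fz) (fs (fs fz)) x = ⊥-elim (<-asym x πk<πj)
  from (fs (fs fz)) fz x = s≤s z≤n
  from (fs (fs fz)) (fs fz) x = s≤s z≤n
  from (fs (fs fz)) (fs (fs fz)) x = ⊥-elim (<-irrefl refl x)

-- The inversion graph of a 321-avoider is triangle-free: the three
-- vertices of a triangle, read left to right, would form a 321.
triangle-free : ∀ π → Av321 π → ∀ a b c →
  InvAdj π a b → InvAdj π b c → InvAdj π a c → ⊥
triangle-free π av a b c ab bc ac =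
  go (adj⇒inversion π _ _ ab) (adj⇒inversion π _ _ bc) (adj⇒inversion π _ _ ac)
  where
  go : Inversion π a b → Inversion π b c → Inversion π a c → ⊥
  go (inj₁ (a<b , vab)) (inj₁ (b<c , vbc)) _                 = av (contains321 π a b c a<b b<c vbc vab)
  go (inj₁ (a<b , vab)) (inj₂ (c<b , vbc)) (inj₁ (a<c , vac)) = av (contains321 π a c b a<c c<b vbc vac)
  go (inj₁ (a<b , vab)) (inj₂ (c<b , vbc)) (inj₂ (c<a , vac)) = av (contains321 π c a b c<a a<b vab vac)
  go (inj₂ (b<a , vab)) (inj₁ (b<c , vbc)) (inj₁ (a<c , vac)) = av (contains321 π b a c b<a a<c vac vab)
  go (inj₂ (b<a , vab)) (inj₁ (b<c , vbc)) (inj₂ (c<a , vac)) = av (contains321 π b c a b<c c<a vac vbc)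
  go (inj₂ (b<a , vab)) (inj₂ (c<b , vbc)) (inj₂ (c<a , vac)) = av (contains321 π c b a c<b b<a vab vbc)
  go (inj₂ (b<a , _))   (inj₂ (c<b , _))   (inj₁ (a<c , _))   = <-asym (<-trans c<b b<a) a<c

two-avoiding : ∀ {n} (xs : List (Fin n)) → Unique xs → 3 ≤ length xs → (z : Fin n) →
  Σ (Fin n) λ x → Σ (Fin n) λ y → x ∈ xs × y ∈ xs × x ≢ y × x ≢ z × y ≢ z
two-avoiding [] _ () z
two-avoiding (_ ∷ []) _ (s≤s ()) z
two-avoiding (_ ∷ _ ∷ []) _ (s≤s (s≤s ())) z
two-avoiding (a ∷ b ∷ c ∷ _) ((a≢b ∷ a≢c ∷ _) ∷ (b≢c ∷ _) ∷ _) _ z with a ≟F z | b ≟F z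
... | yes refl | _ = b , c , there (here refl) , there (there (here refl)) , b≢c , a≢b ∘ sym , a≢c ∘ sym
... | no a≢z | yes refl = a , c , here refl , there (there (here refl)) , a≢c , a≢b , b≢c ∘ sym
... | no a≢z | no b≢z = a , b , here refl , there (here refl) , a≢b , a≢z , b≢z

neighbours : ∀ π → Fin (len π) → List (Fin (len π))
neighbours π u = filter (λ j → T? (invAdjᵇ π u j)) (allFin (len π))

∈-neighbours : ∀ π u {w} → w ∈ neighbours π u → InvAdj π u w
∈-neighbours π u w∈ = proj₂ (∈-filter⁻ (λ j → T? (invAdjᵇ π u j)) {xs = allFin (len π)} w∈)

two-more-neighbours : ∀ π u z → 3 ≤ degree π u → Σ (Fin (len π)) λ x → Σ (Fin (len π)) λ y →
  InvAdj π u x × InvAdj π u y × x ≢ y × x ≢ z × y ≢ z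
two-more-neighbours π u z deg≥3
  with two-avoiding (neighbours π u) (filter⁺ (λ j → T? (invAdjᵇ π u j)) (allFin⁺ (len π))) deg≥3 z
... | x , y , x∈ , y∈ , x≢y , x≢z , y≢z =
  x , y , ∈-neighbours π u x∈ , ∈-neighbours π u y∈ , x≢y , x≢z , y≢z

-- The pattern of π on the positions h(0), …, h(K-1): positions and values
-- are replaced by their ranks.  Its inversion graph is the subgraph of G_π
-- induced on the image of h, listed in left-to-right order.
module InducedPattern (π : Perm) {K : ℕ} (h : Fin K → Fin (len π)) (h-inj : Injective _≡_ _≡_ h) where
  private
    module Pos = Rank (toℕ ∘ h) (h-inj ∘ toℕ-injective)
    module Val = Rank (toℕ ∘ fun π ∘ h) (h-inj ∘ inj π ∘ toℕ-injective)

  -- sorted i is the index whose position is the i-th from the left.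
  sorted : Fin K → Fin K
  sorted i = proj₁ (injective⇒surjective Pos.rk-injective i)

  rk-sorted : ∀ i → Pos.rk (sorted i) ≡ i
  rk-sorted i = proj₂ (injective⇒surjective Pos.rk-injective i)

  reorder : Fin K ↔ Fin K
  reorder = mk↔ₛ′ sorted Pos.rk (λ a → Pos.rk-injective (rk-sorted (Pos.rk a))) rk-sorted

  sorted-injective : ∀ {i j} → sorted i ≡ sorted j → i ≡ j
  sorted-injective {i} {j} e = trans (sym (rk-sorted i)) (trans (cong Pos.rk e) (rk-sorted j))

  σ : Perm
  σ = perm K (Val.rk ∘ sorted) (sorted-injective ∘ Val.rk-injective)

  emb : Fin K → Fin (len π)
  emb = h ∘ sorted

  private
    toℕ-sorted : ∀ i → toℕ i ≡ Pos.rank (sorted i)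
    toℕ-sorted i = trans (cong toℕ (sym (rk-sorted i))) (Pos.rk-toℕ (sorted i))

    pos-to : ∀ i j → i <F j → emb i <F emb j
    pos-to i j lt = Pos.rank-reflects _ _ (subst₂ _<_ (toℕ-sorted i) (toℕ-sorted j) lt)
    pos-from : ∀ i j → emb i <F emb j → i <F j
    pos-from i j lt = subst₂ _<_ (sym (toℕ-sorted i)) (sym (toℕ-sorted j)) (Pos.rank-mono _ _ lt)
    val-to : ∀ i j → fun σ i <F fun σ j → fun π (emb i) <F fun π (emb j)
    val-to i j lt = Val.rank-reflects _ _ (subst₂ _<_ (Val.rk-toℕ (sorted i)) (Val.rk-toℕ (sorted j)) lt)
    val-from : ∀ i j → fun π (emb i) <F fun π (emb j) → fun σ i <F fun σ j
    val-from i j lt = subst₂ _<_ (sym (Val.rk-toℕ (sorted i))) (sym (Val.rk-toℕ (sorted j))) (Val.rank-mono _ _ lt)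

  contained : σ ≼ π
  contained = emb , pos-to , λ i j → val-to i j , val-from i j

  adj-to : ∀ i j → InvAdj σ i j → InvAdj π (emb i) (emb j)
  adj-to i j a with adj⇒inversion σ i j a
  ... | inj₁ (x , y) = inversion⇒adj π _ _ (inj₁ (pos-to i j x , val-to j i y))
  ... | inj₂ (x , y) = inversion⇒adj π _ _ (inj₂ (pos-to j i x , val-to i j y))

  adj-from : ∀ i j → InvAdj π (emb i) (emb j) → InvAdj σ i j
  adj-from i j a with adj⇒inversion π _ _ a
  ... | inj₁ (x , y) = inversion⇒adj σ _ _ (inj₁ (pos-from i j x , val-from j i y))
  ... | inj₂ (x , y) = inversion⇒adj σ _ _ (inj₂ (pos-from j i x , val-from i j y))

record InducedFork (π : Perm) (m : ℕ) : Set where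
  field
    vertex : ForkV m → Fin (len π)
    vertex-inj : Injective _≡_ _≡_ vertex
    adj-to : ∀ x y → InvAdj π (vertex x) (vertex y) → ForkAdj m x y
    adj-from : ∀ x y → ForkAdj m x y → InvAdj π (vertex x) (vertex y)

fork-pattern : ∀ {π m} → InducedFork π m →
  Σ Perm λ σ → σ ≼ π × InU σ × len σ ≡ suc m + 4
fork-pattern {π} {m} F = S.σ , S.contained , (m , φ , adjacency) , refl
  where
  open InducedFork F
  split : Fin (suc m + 4) ↔ ForkV m
  split = +↔⊎ {suc m} {4}
  module S = InducedPattern π (vertex ∘ Inverse.to split)
    (Injection.injective (↔⇒↣ split) ∘ vertex-inj)
  φ : Fin (suc m + 4) ↔ ForkV m
  φ = ↔-trans S.reorder split
  adjacency : ∀ i j → (InvAdj S.σ i j → ForkAdj m (Inverse.to φ i) (Inverse.to φ j))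
                    × (ForkAdj m (Inverse.to φ i) (Inverse.to φ j) → InvAdj S.σ i j)
  adjacency i j = (λ a → adj-to _ _ (S.adj-to i j a)) , (λ f → S.adj-from i j (adj-from _ _ f))

module Walks (π : Perm) where
  V : Set
  V = Fin (len π)

  walk? : ∀ k (u v : V) → Dec (Walk π u v k)
  walk? zero u v with u ≟F v
  ... | yes refl = yes here
  ... | no u≢v = no λ { here → u≢v refl }
  walk? (suc k) u v with any? first-step?
    where
    first-step? : ∀ w → Dec (InvAdj π u w × Walk π w v k)
    first-step? w with T? (invAdjᵇ π u w) | walk? k w v
    ... | yes a | yes rest = yes (a , rest)
    ... | no ¬a | _ = no (¬a ∘ proj₁)
    ... | yes _ | no ¬rest = no (¬rest ∘ proj₂)
  ... | yes (w , a , rest) = yes (step a rest)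
  ... | no none = no λ { (step {v = w} a rest) → none (w , a , rest) }

  _++W_ : ∀ {a b c k l} → Walk π a b k → Walk π b c l → Walk π a c (k + l)
  here ++W w = w
  step x w₁ ++W w = step x (w₁ ++W w)

  reverse : ∀ {a b k} → Walk π a b k → Walk π b a k
  reverse here = here
  reverse {a} {b} {suc k} (step {v = v} x w) =
    subst (Walk π b a) (+-comm k 1) (reverse w ++W step (adj-sym π a v x) here)

  -- The i-th vertex of a walk (its end, beyond the last step).
  at : ∀ {a b k} → Walk π a b k → ℕ → V
  at {a} here i = a
  at {a} (step x w) zero = a
  at (step x w) (suc i) = at w i

  at-start : ∀ {a b k} (w : Walk π a b k) → at w 0 ≡ a
  at-start here = refl
  at-start (step x w) = refl

  at-end : ∀ {a b k} (w : Walk π a b k) → at w k ≡ b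
  at-end here = refl
  at-end (step x w) = at-end w

  prefix : ∀ {a b k} (w : Walk π a b k) i → i ≤ k → Walk π a (at w i) i
  prefix here zero _ = here
  prefix (step x w) zero _ = here
  prefix (step x w) (suc i) (s≤s i≤k) = step x (prefix w i i≤k)

  suffix : ∀ {a b k} (w : Walk π a b k) i → i ≤ k → Walk π (at w i) b (k ∸ i)
  suffix here zero _ = here
  suffix (step x w) zero _ = step x w
  suffix (step x w) (suc i) (s≤s i≤k) = suffix w i i≤k

  at-adjacent : ∀ {a b k} (w : Walk π a b k) i → i < k → InvAdj π (at w i) (at w (suc i))
  at-adjacent (step x here) zero _ = x
  at-adjacent (step x (step y w)) zero _ = x
  at-adjacent (step x w) (suc i) (s≤s i<k) = at-adjacent w i i<k

  Shortest : V → V → ℕ → Set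
  Shortest u v d = Walk π u v d × (∀ i → i < d → ¬ Walk π u v i)

  shortest : ∀ {u v k} → Walk π u v k → Σ ℕ (Shortest u v)
  shortest {u} {v} {k} w = search 0 k (λ _ ()) w
    where
    search : ∀ j r → (∀ i → i < j → ¬ Walk π u v i) → Walk π u v (j + r) → Σ ℕ (Shortest u v)
    search j r none-below w′ with walk? j u v
    ... | yes wj = j , wj , none-below
    search j zero none-below w′ | no ¬wj = ⊥-elim (¬wj (subst (Walk π u v) (+-identityʳ j) w′))
    search j (suc r) none-below w′ | no ¬wj =
      search (suc j) r none-upto-j (subst (Walk π u v) (+-suc j r) w′)
      where
      none-upto-j : ∀ i → i < suc j → ¬ Walk π u v i
      none-upto-j i (s≤s i≤j) with m≤n⇒m<n∨m≡n i≤j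
      ... | inj₁ i<j = none-below i i<j
      ... | inj₂ refl = ¬wj

  record Geodesic (p : ℕ → V) (d : ℕ) : Set where
    field
      adjacent : ∀ i → i < d → InvAdj π (p i) (p (suc i))
      no-shortcut : ∀ i j k → i ≤ d → j ≤ d → Walk π (p i) (p j) k → j ≤ i + k

    geodesic-injective : ∀ {i j} → i ≤ d → j ≤ d → p i ≡ p j → i ≡ j
    geodesic-injective {i} {j} i≤d j≤d e = ≤-antisym
      (subst (i ≤_) (+-identityʳ j) (no-shortcut j i 0 j≤d i≤d (subst (λ z → Walk π z (p i) 0) e here)))
      (subst (j ≤_) (+-identityʳ i) (no-shortcut i j 0 i≤d j≤d (subst (λ z → Walk π (p i) z 0) e here)))

    geodesic-induced : ∀ {i j} → i ≤ d → j ≤ d → InvAdj π (p i) (p j) → (j ≡ suc i) ⊎ (i ≡ suc j)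
    geodesic-induced {i} {j} i≤d j≤d a with <-cmp i j
    ... | tri< i<j _ _ = inj₁ (≤-antisym (subst (j ≤_) (+-comm i 1) (no-shortcut i j 1 i≤d j≤d (step a here))) i<j)
    ... | tri≈ _ refl _ = ⊥-elim (adj-irrefl π (p i) a)
    ... | tri> _ _ j<i = inj₂ (≤-antisym (subst (i ≤_) (+-comm j 1) (no-shortcut j i 1 j≤d i≤d (step (adj-sym π (p i) (p j) a) here))) j<i)

  shortest⇒geodesic : ∀ {u v d} (s : Shortest u v d) → Geodesic (at (proj₁ s)) d
  shortest⇒geodesic {u} {v} {d} (w , minimal) = record { adjacent = at-adjacent w ; no-shortcut = no-shortcut }
    where
    no-shortcut : ∀ i j k → i ≤ d → j ≤ d → Walk π (at w i) (at w j) k → j ≤ i + k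
    no-shortcut i j k i≤d j≤d shortcut = +-cancelʳ-≤ (d ∸ j) j (i + k)
      (subst₂ _≤_ (sym (m+[n∸m]≡n j≤d)) (sym (+-assoc i k (d ∸ j)))
        (≮⇒≥ λ lt → minimal _ lt (prefix w i i≤d ++W (shortcut ++W suffix w j j≤d))))

  reverse-geodesic : ∀ {p d} → Geodesic p d → Geodesic (λ j → p (d ∸ j)) d
  reverse-geodesic {p} {d} g = record { adjacent = adjacent′ ; no-shortcut = no-shortcut′ }
    where
    open Geodesic g
    suc-∸ : ∀ i → i < d → suc (d ∸ suc i) ≡ d ∸ i
    suc-∸ i i<d = sym (+-∸-assoc 1 i<d)
    adjacent′ : ∀ i → i < d → InvAdj π (p (d ∸ i)) (p (d ∸ suc i))
    adjacent′ i i<d = adj-sym π (p (d ∸ suc i)) (p (d ∸ i)) (subst (λ z → InvAdj π (p (d ∸ suc i)) (p z)) (suc-∸ i i<d)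
      (adjacent (d ∸ suc i) (subst (_≤ d) (sym (suc-∸ i i<d)) (m∸n≤m d i))))
    no-shortcut′ : ∀ i j k → i ≤ d → j ≤ d → Walk π (p (d ∸ i)) (p (d ∸ j)) k → j ≤ i + k
    no-shortcut′ i j k i≤d j≤d w = +-cancelʳ-≤ (d ∸ j) j (i + k)
      (subst₂ _≤_ (sym (m+[n∸m]≡n j≤d))
        (trans (cong (i +_) (+-comm (d ∸ j) k)) (sym (+-assoc i k (d ∸ j))))
        (subst (_≤ i + ((d ∸ j) + k)) (m+[n∸m]≡n i≤d)
          (+-monoʳ-≤ i (no-shortcut (d ∸ j) (d ∸ i) k (m∸n≤m d j) (m∸n≤m d i) (reverse w)))))

pair : {A : Set} → A → A → Fin 2 → A
pair x y fz = x
pair x y (fs _) = y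

module Ends (π : Perm) (p : ℕ → Fin (len π)) (d : ℕ) where
  open Walks π

  record Pendant (c : ℕ) (t : V) : Set where
    field
      attached : InvAdj π t (p c)
      attached-only : ∀ j → c ≤ j → j ≤ d → InvAdj π t (p j) → j ≡ c
      off-path : ∀ j → c ≤ j → j ≤ d → t ≢ p j
      near-start : Walk π (p 0) t 1

  record End : Set where
    field
      anchor : ℕ
      anchor≤2 : anchor ≤ 2
      leaf : Fin 2 → V
      pendant : ∀ b → Pendant anchor (leaf b)
      leaves-distinct : leaf fz ≢ leaf (fs fz)
      leaves-nonadjacent : ¬ InvAdj π (leaf fz) (leaf (fs fz))

    leaf-injective : Injective _≡_ _≡_ leaf
    leaf-injective {fz} {fz} _ = refl
    leaf-injective {fz} {fs fz} e = ⊥-elim (leaves-distinct e)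
    leaf-injective {fs fz} {fz} e = ⊥-elim (leaves-distinct (sym e))
    leaf-injective {fs fz} {fs fz} _ = refl

    leaves-independent : ∀ a b → ¬ InvAdj π (leaf a) (leaf b)
    leaves-independent fz fz = adj-irrefl π (leaf fz)
    leaves-independent fz (fs fz) = leaves-nonadjacent
    leaves-independent (fs fz) fz = leaves-nonadjacent ∘ adj-sym π (leaf (fs fz)) (leaf fz)
    leaves-independent (fs fz) (fs fz) = adj-irrefl π (leaf (fs fz))

  -- With p₁ and two further neighbours x, y of p₀:
  -- if x (or y) is adjacent to p₂ then it and p₁ are pendants at p₂,
  -- otherwise x and y are pendants at p₀.
  module _ (av : Av321 π) (g : Geodesic p d) (d≥2 : 2 ≤ d) where
    open Geodesic g

    private
      p₀p₁ : InvAdj π (p 0) (p 1)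
      p₀p₁ = adjacent 0 (≤-trans (s≤s z≤n) d≥2)

      within-2 : ∀ {t j} → InvAdj π (p 0) t → j ≤ d → InvAdj π t (p j) → j ≤ 2
      within-2 a j≤d b = no-shortcut 0 _ 2 z≤n j≤d (step a (step b here))

      within-1 : ∀ {t j} → InvAdj π (p 0) t → j ≤ d → t ≡ p j → j ≤ 1
      within-1 a j≤d refl = no-shortcut 0 _ 1 z≤n j≤d (step a here)

      not-adj-p₁ : ∀ {t} → InvAdj π (p 0) t → ¬ InvAdj π t (p 1)
      not-adj-p₁ {t} a b = triangle-free π av (p 0) t (p 1) a b p₀p₁

    pendant-at-0 : ∀ {t} → InvAdj π (p 0) t → t ≢ p 1 → ¬ InvAdj π t (p 2) → Pendant 0 t
    pendant-at-0 {t} a t≢p₁ ¬t~p₂ = record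
      { attached = adj-sym π (p 0) t a ; attached-only = only ; off-path = off
      ; near-start = step a here }
      where
      only : ∀ j → 0 ≤ j → j ≤ d → InvAdj π t (p j) → j ≡ 0
      only zero _ _ _ = refl
      only 1 _ _ b = ⊥-elim (not-adj-p₁ a b)
      only 2 _ _ b = ⊥-elim (¬t~p₂ b)
      only (suc (suc (suc j))) _ j≤d b with within-2 a j≤d b
      ... | s≤s (s≤s ())
      off : ∀ j → 0 ≤ j → j ≤ d → t ≢ p j
      off zero _ _ refl = adj-irrefl π (p 0) a
      off 1 _ _ e = t≢p₁ e
      off (suc (suc j)) _ j≤d e with within-1 a j≤d e
      ... | s≤s ()

    pendant-at-2 : ∀ {t} → InvAdj π (p 0) t → InvAdj π t (p 2) → Pendant 2 t
    pendant-at-2 {t} a b = record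
      { attached = b
      ; attached-only = λ j 2≤j j≤d c → ≤-antisym (within-2 a j≤d c) 2≤j
      ; off-path = λ j 2≤j j≤d e → <⇒≱ (s≤s (within-1 a j≤d e)) 2≤j
      ; near-start = step a here }

    second-vertex-pendant : Pendant 2 (p 1)
    second-vertex-pendant = record
      { attached = adjacent 1 d≥2
      ; attached-only = λ j 2≤j j≤d c → ≤-antisym (no-shortcut 1 j 1 1≤d j≤d (step c here)) 2≤j
      ; off-path = λ j 2≤j j≤d e → <⇒≱ (s≤s (no-shortcut 1 j 0 1≤d j≤d (subst (λ z → Walk π (p 1) z 0) e here))) 2≤j
      ; near-start = step p₀p₁ here }
      where
      1≤d : 1 ≤ d
      1≤d = ≤-trans (s≤s z≤n) d≥2

    geodesic-end : 3 ≤ degree π (p 0) → End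
    geodesic-end deg≥3 with two-more-neighbours π (p 0) (p 1) deg≥3
    ... | x , y , p₀x , p₀y , x≢y , x≢p₁ , y≢p₁
        with T? (invAdjᵇ π x (p 2)) | T? (invAdjᵇ π y (p 2))
    ... | yes x~p₂ | _ = record
      { anchor = 2 ; anchor≤2 = ≤-refl ; leaf = pair x (p 1)
      ; pendant = λ { fz → pendant-at-2 p₀x x~p₂ ; (fs fz) → second-vertex-pendant }
      ; leaves-distinct = x≢p₁ ; leaves-nonadjacent = not-adj-p₁ p₀x }
    ... | no _ | yes y~p₂ = record
      { anchor = 2 ; anchor≤2 = ≤-refl ; leaf = pair y (p 1)
      ; pendant = λ { fz → pendant-at-2 p₀y y~p₂ ; (fs fz) → second-vertex-pendant }
      ; leaves-distinct = y≢p₁ ; leaves-nonadjacent = not-adj-p₁ p₀y }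
    ... | no ¬x~p₂ | no ¬y~p₂ = record
      { anchor = 0 ; anchor≤2 = z≤n ; leaf = pair x y
      ; pendant = λ { fz → pendant-at-0 p₀x x≢p₁ ¬x~p₂ ; (fs fz) → pendant-at-0 p₀y y≢p₁ ¬y~p₂ }
      ; leaves-distinct = x≢y ; leaves-nonadjacent = λ b → triangle-free π av (p 0) x y p₀x b p₀y }

-- A geodesic p₀ … p_d with d ≥ 4 in a 321-avoider whose end vertices have
-- degree ≥ 3 carries an induced double-ended fork: its path runs between
-- the anchors of the two ends, its leaves are the pendants of the ends.
module ForkInGeodesic (π : Perm) (av : Av321 π) {p : ℕ → Fin (len π)} {d : ℕ}
  (g : Walks.Geodesic π p d) (d≥4 : 4 ≤ d)
  (deg-start : 3 ≤ degree π (p 0)) (deg-end : 3 ≤ degree π (p d)) where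
  open Walks π
  open Geodesic g

  private
    d≥2 : 2 ≤ d
    d≥2 = ≤-trans (s≤s (s≤s z≤n)) d≥4

    q : ℕ → V
    q j = p (d ∸ j)

    module L = Ends.End (Ends.geodesic-end π p d av g d≥2 deg-start)
    module R = Ends.End (Ends.geodesic-end π q d av (reverse-geodesic g) d≥2 deg-end)
    module LP (b : Fin 2) = Ends.Pendant (L.pendant b)
    module RP (b : Fin 2) = Ends.Pendant (R.pendant b)

  -- e is the index of the right anchor on p; the fork path is p_{cL} … p_e.
  e : ℕ
  e = d ∸ R.anchor

  m : ℕ
  m = e ∸ L.anchor

  private
    right-anchor≤d : R.anchor ≤ d
    right-anchor≤d = ≤-trans R.anchor≤2 d≥2

    left-anchor+m≡e : L.anchor + m ≡ e
    left-anchor+m≡e = m+[n∸m]≡n (m+n≤o⇒m≤o∸n L.anchor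
      (≤-trans (+-mono-≤ L.anchor≤2 R.anchor≤2) d≥4))

    e≤d : e ≤ d
    e≤d = m∸n≤m d R.anchor

    shift-cancel : ∀ a b → L.anchor + a ≡ L.anchor + b → a ≡ b
    shift-cancel = +-cancelˡ-≡ L.anchor

  index : Fin (suc m) → ℕ
  index i = L.anchor + toℕ i

  path : Fin (suc m) → V
  path i = p (index i)

  private
    index≤e : ∀ i → index i ≤ e
    index≤e i = subst (index i ≤_) left-anchor+m≡e (+-monoʳ-≤ L.anchor (toℕ≤pred[n] i))

    index≤d : ∀ i → index i ≤ d
    index≤d i = ≤-trans (index≤e i) e≤d

    index-suc : ∀ i j → index j ≡ suc (index i) → toℕ j ≡ suc (toℕ i)
    index-suc i j idx = shift-cancel _ _ (trans idx (sym (+-suc L.anchor (toℕ i))))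

  path-injective : Injective _≡_ _≡_ path
  path-injective {i} {j} eq =
    toℕ-injective (shift-cancel _ _ (geodesic-injective (index≤d i) (index≤d j) eq))

  path-adj-to : ∀ i j → InvAdj π (path i) (path j) → (toℕ j ≡ suc (toℕ i)) ⊎ (toℕ i ≡ suc (toℕ j))
  path-adj-to i j a = map⊎ (index-suc i j) (index-suc j i) (geodesic-induced (index≤d i) (index≤d j) a)

  path-adj-from : ∀ i j → toℕ j ≡ suc (toℕ i) → InvAdj π (path i) (path j)
  path-adj-from i j j≡1+i =
    subst (InvAdj π (path i) ∘ p) (sym idx) (adjacent (index i) (subst (_≤ d) idx (index≤d j)))
    where
    idx : index j ≡ suc (index i)
    idx = trans (cong (L.anchor +_) j≡1+i) (+-suc L.anchor (toℕ i))

  private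
    mirror : ∀ {k} → k ≤ e → R.anchor ≤ d ∸ k
    mirror {k} k≤e = m+n≤o⇒m≤o∸n R.anchor
      (subst (_≤ d) (+-comm k R.anchor) (m≤o∸n⇒m+n≤o k right-anchor≤d k≤e))

    q-mirror : ∀ {k} → k ≤ d → q (d ∸ k) ≡ p k
    q-mirror k≤d = cong p (m∸[m∸n]≡n k≤d)

  right-attached-only : ∀ b k → k ≤ e → InvAdj π (R.leaf b) (p k) → k ≡ e
  right-attached-only b k k≤e a = begin
    k              ≡⟨ sym (m∸[m∸n]≡n k≤d) ⟩
    d ∸ (d ∸ k)    ≡⟨ cong (d ∸_) (RP.attached-only b (d ∸ k) (mirror k≤e) (m∸n≤m d k)
                        (subst (InvAdj π (R.leaf b)) (sym (q-mirror k≤d)) a)) ⟩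
    d ∸ R.anchor   ∎
    where
    open ≡-Reasoning
    k≤d : k ≤ d
    k≤d = ≤-trans k≤e e≤d

  right-off-path : ∀ b k → k ≤ e → R.leaf b ≢ p k
  right-off-path b k k≤e eq =
    RP.off-path b (d ∸ k) (mirror k≤e) (m∸n≤m d k) (trans eq (sym (q-mirror (≤-trans k≤e e≤d))))

  leaf : Fin 2 ⊎ Fin 2 → V
  leaf = [ L.leaf , R.leaf ]′

  Attached : Fin 2 ⊎ Fin 2 → Fin (suc m) → Set
  Attached (inj₁ _) i = toℕ i ≡ 0
  Attached (inj₂ _) i = toℕ i ≡ m

  leaf-path-to : ∀ s i → InvAdj π (leaf s) (path i) → Attached s i
  leaf-path-to (inj₁ b) i a = shift-cancel _ _
    (trans (LP.attached-only b (index i) (m≤m+n _ _) (index≤d i) a) (sym (+-identityʳ L.anchor)))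
  leaf-path-to (inj₂ b) i a = shift-cancel _ _
    (trans (right-attached-only b (index i) (index≤e i) a) (sym left-anchor+m≡e))

  leaf-path-from : ∀ s i → Attached s i → InvAdj π (leaf s) (path i)
  leaf-path-from (inj₁ b) i i≡0 = subst (InvAdj π (L.leaf b) ∘ p)
    (sym (trans (cong (L.anchor +_) i≡0) (+-identityʳ L.anchor))) (LP.attached b)
  leaf-path-from (inj₂ b) i i≡m = subst (InvAdj π (R.leaf b) ∘ p)
    (sym (trans (cong (L.anchor +_) i≡m) left-anchor+m≡e)) (RP.attached b)

  leaf-off-path : ∀ s i → leaf s ≢ path i
  leaf-off-path (inj₁ b) i = LP.off-path b (index i) (m≤m+n _ _) (index≤d i)
  leaf-off-path (inj₂ b) i = right-off-path b (index i) (index≤e i)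

  -- Left and right leaves are at distance ≥ 2, since joining them by a walk
  -- of length ≤ 1 gives a walk p₀ → p_d of length ≤ 3 < d.
  leaves-apart : ∀ a b {k} → k ≤ 1 → ¬ Walk π (L.leaf a) (R.leaf b) k
  leaves-apart a b k≤1 w = <⇒≱ (s≤s (s≤s (+-monoˡ-≤ 1 k≤1)))
    (≤-trans d≥4 (no-shortcut 0 d _ z≤n ≤-refl (LP.near-start a ++W (w ++W reverse (RP.near-start b)))))

  leaf-injective : Injective _≡_ _≡_ leaf
  leaf-injective {inj₁ a} {inj₁ a′} eq = cong inj₁ (L.leaf-injective eq)
  leaf-injective {inj₁ a} {inj₂ b} eq = ⊥-elim (leaves-apart a b z≤n (subst (λ z → Walk π (L.leaf a) z 0) eq here))
  leaf-injective {inj₂ b} {inj₁ a} eq = ⊥-elim (leaves-apart a b z≤n (subst (λ z → Walk π (L.leaf a) z 0) (sym eq) here))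
  leaf-injective {inj₂ b} {inj₂ b′} eq = cong inj₂ (R.leaf-injective eq)

  leaves-independent : ∀ s s′ → ¬ InvAdj π (leaf s) (leaf s′)
  leaves-independent (inj₁ a) (inj₁ a′) = L.leaves-independent a a′
  leaves-independent (inj₁ a) (inj₂ b) x = leaves-apart a b ≤-refl (step x here)
  leaves-independent (inj₂ b) (inj₁ a) x = leaves-apart a b ≤-refl (step (adj-sym π (R.leaf b) (L.leaf a) x) here)
  leaves-independent (inj₂ b) (inj₂ b′) = R.leaves-independent b b′

  vertex : ForkV m → V
  vertex (inj₁ i) = path i
  vertex (inj₂ l) = leaf (splitAt 2 l)

  attached⇒pathLeafAdj : ∀ l i → Attached (splitAt 2 l) i → PathLeafAdj m i l
  attached⇒pathLeafAdj fz i eq = inj₁ (eq , s≤s z≤n)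
  attached⇒pathLeafAdj (fs fz) i eq = inj₁ (eq , s≤s (s≤s z≤n))
  attached⇒pathLeafAdj (fs (fs fz)) i eq = inj₂ (eq , ≤-refl)
  attached⇒pathLeafAdj (fs (fs (fs fz))) i eq = inj₂ (eq , s≤s (s≤s z≤n))

  pathLeafAdj⇒attached : ∀ l i → PathLeafAdj m i l → Attached (splitAt 2 l) i
  pathLeafAdj⇒attached fz i (inj₁ (eq , _)) = eq
  pathLeafAdj⇒attached fz i (inj₂ (_ , ()))
  pathLeafAdj⇒attached (fs fz) i (inj₁ (eq , _)) = eq
  pathLeafAdj⇒attached (fs fz) i (inj₂ (_ , s≤s ()))
  pathLeafAdj⇒attached (fs (fs fz)) i (inj₁ (_ , s≤s (s≤s ())))
  pathLeafAdj⇒attached (fs (fs fz)) i (inj₂ (eq , _)) = eq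
  pathLeafAdj⇒attached (fs (fs (fs fz))) i (inj₁ (_ , s≤s (s≤s ())))
  pathLeafAdj⇒attached (fs (fs (fs fz))) i (inj₂ (eq , _)) = eq

  vertex-injective : Injective _≡_ _≡_ vertex
  vertex-injective {inj₁ i} {inj₁ j} eq = cong inj₁ (path-injective eq)
  vertex-injective {inj₁ i} {inj₂ l} eq = ⊥-elim (leaf-off-path (splitAt 2 l) i (sym eq))
  vertex-injective {inj₂ l} {inj₁ i} eq = ⊥-elim (leaf-off-path (splitAt 2 l) i eq)
  vertex-injective {inj₂ l} {inj₂ l′} eq =
    cong inj₂ (Injection.injective (↔⇒↣ (+↔⊎ {2} {2})) (leaf-injective eq))

  fork-adj-to : ∀ x y → InvAdj π (vertex x) (vertex y) → ForkAdj m x y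
  fork-adj-to (inj₁ i) (inj₁ j) a = path-adj-to i j a
  fork-adj-to (inj₁ i) (inj₂ l) a =
    attached⇒pathLeafAdj l i (leaf-path-to _ i (adj-sym π (path i) (vertex (inj₂ l)) a))
  fork-adj-to (inj₂ l) (inj₁ i) a = attached⇒pathLeafAdj l i (leaf-path-to _ i a)
  fork-adj-to (inj₂ l) (inj₂ l′) a = leaves-independent (splitAt 2 l) (splitAt 2 l′) a

  fork-adj-from : ∀ x y → ForkAdj m x y → InvAdj π (vertex x) (vertex y)
  fork-adj-from (inj₁ i) (inj₁ j) (inj₁ j≡1+i) = path-adj-from i j j≡1+i
  fork-adj-from (inj₁ i) (inj₁ j) (inj₂ i≡1+j) = adj-sym π (path j) (path i) (path-adj-from j i i≡1+j)
  fork-adj-from (inj₁ i) (inj₂ l) f =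
    adj-sym π (vertex (inj₂ l)) (path i) (leaf-path-from _ i (pathLeafAdj⇒attached l i f))
  fork-adj-from (inj₂ l) (inj₁ i) f = leaf-path-from _ i (pathLeafAdj⇒attached l i f)
  fork-adj-from (inj₂ l) (inj₂ l′) ()

  fork : InducedFork π m
  fork = record
    { vertex = vertex ; vertex-inj = vertex-injective
    ; adj-to = fork-adj-to ; adj-from = fork-adj-from }

  -- The fork is long: at most four path vertices lie outside it.
  length-bound : d ≤ suc m + 4
  length-bound = begin
    d                       ≡⟨ sym (m∸n+n≡m right-anchor≤d) ⟩
    e + R.anchor            ≡⟨ cong (_+ R.anchor) (sym left-anchor+m≡e) ⟩
    L.anchor + m + R.anchor ≤⟨ +-mono-≤ (+-monoˡ-≤ m L.anchor≤2) R.anchor≤2 ⟩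
    2 + m + 2               ≡⟨ cong (2 +_) (+-comm m 2) ⟩
    4 + m                   ≡⟨ +-comm 4 m ⟩
    m + 4                   ≤⟨ n≤1+n (m + 4) ⟩
    suc m + 4               ∎
    where open ≤-Reasoning

bounded-length : ∀ {S : Perm → Set} → FinitePerms S → ∃[ N ] (∀ π → S π → len π ≤ N)
bounded-length (L , covers) = max-len L , λ π Sπ → len≤max-len π L (covers π Sπ)
  where
  max-len : List Perm → ℕ
  max-len [] = 0
  max-len (τ ∷ τs) = len τ ⊔ max-len τs
  len≤max-len : ∀ π τs → Any (SamePerm π) τs → len π ≤ max-len τs
  len≤max-len π (τ ∷ τs) (here (len≡ , _)) = subst (_≤ len τ ⊔ max-len τs) (sym len≡) (m≤m⊔n (len τ) (max-len τs))
  len≤max-len π (τ ∷ τs) (there hit) = ≤-trans (len≤max-len π τs hit) (m≤n⊔m (len τ) (max-len τs))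

module _ (C : Perm → Set) (closed : IsPermClass C) (av : ∀ π → C π → Av321 π)
         (N : ℕ) (bound : ∀ σ → C σ × InU σ → len σ ≤ N) where

  long-geodesic-bound : ∀ π → C π → ∀ {p d} → Walks.Geodesic π p d → 4 ≤ d →
    3 ≤ degree π (p 0) → 3 ≤ degree π (p d) → d ≤ N
  long-geodesic-bound π Cπ {d = d} g d≥4 deg₀ deg-d =
    let (σ , σ≼π , σ∈U , len-σ) = fork-pattern F.fork in
    begin
      d              ≤⟨ F.length-bound ⟩
      suc F.m + 4    ≡⟨ sym len-σ ⟩
      len σ          ≤⟨ bound σ (closed σ π Cπ σ≼π , σ∈U) ⟩
      N              ∎
    where
    open ≤-Reasoning
    module F = ForkInGeodesic π (av π Cπ) g d≥4 deg₀ deg-d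

  geodesic-bound : ∀ π → C π → ∀ {p d} → Walks.Geodesic π p d →
    3 ≤ degree π (p 0) → 3 ≤ degree π (p d) → d ≤ 3 + N
  geodesic-bound π Cπ {d = d} g deg₀ deg-d with 4 ≤? d
  ... | no d≱4 = ≤-trans (≤-pred (≰⇒> d≱4)) (m≤m+n 3 N)
  ... | yes d≥4 = ≤-trans (long-geodesic-bound π Cπ g d≥4 deg₀ deg-d) (m≤n+m N 3)

proposition9p2 : (C : Perm → Set) → IsPermClass C → (∀ π → C π → Av321 π)
    → FinitePerms (λ π → C π × InU π)
    → ∃[ ℓ ] (∀ π → C π → Connected π → ∀ u v → 3 ≤ degree π u → 3 ≤ degree π v
      → DistAtMost π u v ℓ)
proposition9p2 C closed av finite = 3 + N , distance-bound
  where
  N : ℕ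
  N = proj₁ (bounded-length finite)

  distance-bound : ∀ π → C π → Connected π → ∀ u v → 3 ≤ degree π u → 3 ≤ degree π v
    → DistAtMost π u v (3 + N)
  distance-bound π Cπ connected u v deg-u deg-v =
    let (_ , w) = connected u v
        (d , s) = shortest w
        walk = proj₁ s
    in d
     , geodesic-bound C closed av N (proj₂ (bounded-length finite)) π Cπ (shortest⇒geodesic s)
         (subst (λ z → 3 ≤ degree π z) (sym (at-start walk)) deg-u)
         (subst (λ z → 3 ≤ degree π z) (sym (at-end walk)) deg-v)
     , walk
    where open Walks π
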